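{- Let $G$ be a connected bipartite graph of order $n\geq 3$. Then $\chi^\Sigma_g(G)=3$ if $G$ is ugly, and $\chi^\Sigma_g(G)=2$ otherwise.
   Context: All groups are Abelian, written additively with neutral element $0$. For a graph $G$ and an Abelian group $\mathcal{G}$, an edge labelling $f:E(G)\to\mathcal{G}$ defines the weighted degree $w(v)=\sum_{e\ni v} f(e)$ of each vertex $v$. The labelling $f$ is called vertex-$\mathcal{G}$-colouring if $w(u)\neq w(v)$ for every edge $uv$ of $G$. The group sum chromatic number $\chi^\Sigma_g(G)$ is the smallest integer $s$ such that for every Abelian group $\mathcal{G}$ of order $s$ there exists a vertex-$\mathcal{G}$-colouring labelling $f:E(G)\to\mathcal{G}$. A colour class is odd (even) if it has odd (even) cardinality. A connected graph $G$ of order at least $3$ is called ugly if either (i) $\chi(G)=4k+2$ for some integer $k\geq 0$ and in every proper $\chi(G)$-colouring of $G$ all colour classes are odd, or (ii) $\chi(G)=2^q$ for some integer $q\geq 2$ and in every proper $\chi(G)$-colouring of $G$ either exactly $2$ or exactly $2^q-2$ colour classes are odd. (In particular, a connected bipartite graph of order at least $3$ is ugly exactly when both parts of its bipartition have odd size.) -}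

module Defs where

open import Level using (0ℓ)
open import Data.Bool using (Bool; true; false; if_then_else_)
open import Data.Nat using (ℕ; zero; suc; _+_; _*_; _∸_; _^_; _≤_; _<_; _%_)
open import Data.Fin using (Fin)
open import Data.Fin.Properties using () renaming (_≟_ to _≟ᶠ_)
open import Data.List using (List; map; allFin)
open import Data.Nat.ListAction using (sum)
open import Data.Product using (Σ; ∃; ∃-syntax; _×_; _,_)
open import Data.Sum using (_⊎_)
open import Relation.Nullary using (¬_; does)
open import Relation.Binary.PropositionalEquality using (_≡_; _≢_)
import Relation.Binary.PropositionalEquality as ≡
open import Algebra.Bundles using (AbelianGroup)
open import Function.Bundles using (Bijection)
import Algebra.Definitions.RawMonoid as RM

record Graph (n : ℕ) : Set where
  field
    adj    : Fin n → Fin n → Bool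
    sym    : ∀ u v → adj u v ≡ adj v u
    irrefl : ∀ u → adj u u ≡ false

open Graph public

Edge : ∀ {n} → Graph n → Fin n → Fin n → Set
Edge G u v = adj G u v ≡ true

data Reach {n} (G : Graph n) (u : Fin n) : Fin n → Set where
  here : Reach G u u
  step : ∀ {v w} → Reach G u v → Edge G v w → Reach G u w

Connected : ∀ {n} → Graph n → Set
Connected {n} G = ∀ (u v : Fin n) → Reach G u v

ProperColouring : ∀ {n} → Graph n → ℕ → Set
ProperColouring {n} G k =
  Σ (Fin n → Fin k) λ c → ∀ u v → Edge G u v → c u ≢ c v

Colourable : ∀ {n} → Graph n → ℕ → Set
Colourable G k = ProperColouring G k

Bipartite : ∀ {n} → Graph n → Set
Bipartite G = Colourable G 2

ChromaticNumberIs : ∀ {n} → Graph n → ℕ → Set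
ChromaticNumberIs G k = Colourable G k × (∀ j → j < k → ¬ Colourable G j)

classSize : ∀ {n k} → (Fin n → Fin k) → Fin k → ℕ
classSize {n} c i = sum (map (λ v → if does (c v ≟ᶠ i) then 1 else 0) (allFin n))

Odd : ℕ → Set
Odd m = m % 2 ≡ 1

numOddClasses : ∀ {n k} → (Fin n → Fin k) → ℕ
numOddClasses {n} {k} c =
  sum (map (λ i → if does (classSize c i % 2 Data.Nat.≟ 1) then 1 else 0) (allFin k))

Ugly : ∀ {n} → Graph n → Set
Ugly {n} G =
  Connected G × 3 ≤ n ×
  ( (∃[ k ] ChromaticNumberIs G (4 * k + 2)
       × (∀ (c : Fin n → Fin (4 * k + 2)) → (∀ u v → Edge G u v → c u ≢ c v)
            → ∀ i → Odd (classSize c i)))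
  ⊎ (∃[ q ] 2 ≤ q × ChromaticNumberIs G (2 ^ q)
       × (∀ (c : Fin n → Fin (2 ^ q)) → (∀ u v → Edge G u v → c u ≢ c v)
            → numOddClasses c ≡ 2 ⊎ numOddClasses c ≡ 2 ^ q ∸ 2)))

HasOrder : AbelianGroup 0ℓ 0ℓ → ℕ → Set
HasOrder A s = Bijection (AbelianGroup.setoid A) (≡.setoid (Fin s))

module _ (A : AbelianGroup 0ℓ 0ℓ) where
  open AbelianGroup A

  weightedDegree : ∀ {n} → Graph n → (Fin n → Fin n → Carrier) → Fin n → Carrier
  weightedDegree G f v =
    RM.sum rawMonoid (λ u → if adj G v u then f v u else ε)

  -- f is a labelling of E(G): the label of an edge does not depend on orientation
  IsEdgeLabelling : ∀ {n} → Graph n → (Fin n → Fin n → Carrier) → Set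
  IsEdgeLabelling G f = ∀ u v → Edge G u v → f u v ≈ f v u

  VertexColouring : ∀ {n} → Graph n → (Fin n → Fin n → Carrier) → Set
  VertexColouring G f =
    ∀ u v → Edge G u v → ¬ (weightedDegree G f u ≈ weightedDegree G f v)

GroupColourable : ∀ {n} → Graph n → ℕ → Set₁
GroupColourable {n} G s =
  ∀ (A : AbelianGroup 0ℓ 0ℓ) → HasOrder A s →
    Σ (Fin n → Fin n → AbelianGroup.Carrier A)
      λ f → IsEdgeLabelling A G f × VertexColouring A G f

GroupSumChromaticNumberIs : ∀ {n} → Graph n → ℕ → Set₁
GroupSumChromaticNumberIs G s =
  1 ≤ s × GroupColourable G s × (∀ t → 1 ≤ t → t < s → ¬ GroupColourable G t)

-- Two facts about weighted degrees drive the proof. First, fix a proper 2-colouring and a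
-- root r of the connected graph: any prescribed degrees d are attained at every vertex other
-- than r, while r receives d r plus the signed sum of d (minus on the class of r, plus on the
-- other), by superposing, for each v, the labels d v, -d v, d v, … along a walk from v to r.
-- Second, over a group of exponent 2 the degrees of any edge labelling sum to 0, since each
-- label is counted at both of its ends.
-- Over a group of order 3 we give one class the degree b ≠ 0 and the other class degree 0
-- except at two of its vertices (the root and one more), whose values are chosen to avoid b.
-- Over ℤ₂ we give one class the degree 1 and the other 0; the root then comes out right iff
-- that class is even. If both classes are odd (the bipartite ugly case), the degrees of a
-- vertex-colouring labelling would form a proper 2-colouring whose class of weight 1 is odd,
-- so they would sum to 1, contradicting the handshake identity. A group of order 1 cannot
-- separate the ends of an edge.

module Submission where

open import Defs
open import Level using (0ℓ)
open import Algebra.Bundles using (AbelianGroup; CommutativeRing; Group)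
import Algebra.Construct.Terminal as Terminal
open import Data.Bool using (Bool; true; false; if_then_else_; _∧_)
open import Data.Bool.Properties using (∧-comm; xor-∧-commutativeRing)
open import Data.Empty using (⊥-elim)
open import Data.Fin using (Fin; zero; suc; opposite)
open import Data.Fin.Properties using (2↔Bool) renaming (_≟_ to _≟ᶠ_)
open import Data.List using (allFin; tabulate)
import Data.List.Properties as List
import Data.Nat.ListAction as ListAction
open import Data.Nat as ℕ using (ℕ; zero; suc; _≤_; _%_; z≤n; s≤s; _≟_)
open import Data.Nat.DivMod using (m%n<n)
open import Data.Nat.Properties using (<⇒≤; m≤n+m; ^-monoʳ-<)
open import Data.Product using (Σ; ∃-syntax; _×_; _,_; proj₁; proj₂; uncurry)
open import Data.Sum using (_⊎_; inj₁; inj₂)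
open import Data.Unit.Polymorphic using (tt)
open import Function.Base using (_∘_)
open import Function.Bundles using (Bijection; mk⇔)
open import Function.Properties.Inverse using (↔⇒⤖; ↔-sym)
open import Relation.Nullary using (¬_; does; yes; no)
open import Relation.Nullary.Decidable using (does-⇔)
open import Relation.Binary.PropositionalEquality as ≡ using (_≡_; _≢_; refl; cong)

fin2-≢-≢⇒≡ : {a b c : Fin 2} → a ≢ b → a ≢ c → b ≡ c
fin2-≢-≢⇒≡ {zero}     {zero}                 a≢b _   = ⊥-elim (a≢b refl)
fin2-≢-≢⇒≡ {zero}     {suc zero} {zero}     _   a≢c = ⊥-elim (a≢c refl)
fin2-≢-≢⇒≡ {zero}     {suc zero} {suc zero} _   _   = refl
fin2-≢-≢⇒≡ {suc zero} {zero}     {zero}     _   _   = refl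
fin2-≢-≢⇒≡ {suc zero} {zero}     {suc zero} _   a≢c = ⊥-elim (a≢c refl)
fin2-≢-≢⇒≡ {suc zero} {suc zero}             a≢b _   = ⊥-elim (a≢b refl)

opposite-≢ : (i : Fin 2) → opposite i ≢ i
opposite-≢ zero       ()
opposite-≢ (suc zero) ()

fin2-≢⇒≡opposite : {a b : Fin 2} → a ≢ b → b ≡ opposite a
fin2-≢⇒≡opposite {a} a≢b = fin2-≢-≢⇒≡ a≢b (opposite-≢ a ∘ ≡.sym)

does-opposite-≟ : (a i : Fin 2) → does (opposite a ≟ᶠ i) ≡ does (a ≟ᶠ opposite i)
does-opposite-≟ zero       zero       = refl
does-opposite-≟ zero       (suc zero) = refl
does-opposite-≟ (suc zero) zero       = refl
does-opposite-≟ (suc zero) (suc zero) = refl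

does-≟-sym : ∀ {n} (u v : Fin n) → does (u ≟ᶠ v) ≡ does (v ≟ᶠ u)
does-≟-sym u v = does-⇔ (mk⇔ ≡.sym ≡.sym) (u ≟ᶠ v) (v ≟ᶠ u)

avoid-two : ∀ {m} (i j : Fin (3 ℕ.+ m)) → ∃[ k ] k ≢ i × k ≢ j
avoid-two (suc _)       (suc _)       = zero , (λ ()) , (λ ())
avoid-two zero          zero          = suc zero , (λ ()) , (λ ())
avoid-two zero          (suc zero)    = suc (suc zero) , (λ ()) , (λ ())
avoid-two zero          (suc (suc _)) = suc zero , (λ ()) , (λ ())
avoid-two (suc zero)    zero          = suc (suc zero) , (λ ()) , (λ ())
avoid-two (suc (suc _)) zero          = suc zero , (λ ()) , (λ ())

monochromatic-pair : ∀ {n} → 3 ≤ n → (c : Fin n → Fin 2) → ∃[ r ] ∃[ s ] s ≢ r × c s ≡ c r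
monochromatic-pair (s≤s (s≤s (s≤s _))) c with c zero ≟ᶠ c (suc zero) | c zero ≟ᶠ c (suc (suc zero))
... | yes c₀≡c₁ | _         = zero , suc zero , (λ ()) , ≡.sym c₀≡c₁
... | no _      | yes c₀≡c₂ = zero , suc (suc zero) , (λ ()) , ≡.sym c₀≡c₂
... | no c₀≢c₁  | no c₀≢c₂  = suc zero , suc (suc zero) , (λ ()) , ≡.sym (fin2-≢-≢⇒≡ c₀≢c₁ c₀≢c₂)

¬odd⇒even : ∀ m → ¬ Odd m → m % 2 ≡ 0
¬odd⇒even m ¬odd with m % 2 | m%n<n m 2
... | 0           | _                 = refl
... | 1           | _                 = ⊥-elim (¬odd refl)
... | suc (suc _) | s≤s (s≤s ())

classSize-cong : ∀ {n k} (c c′ : Fin n → Fin k) {i j} →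
  (∀ v → does (c v ≟ᶠ i) ≡ does (c′ v ≟ᶠ j)) → classSize c i ≡ classSize c′ j
classSize-cong {n} _ _ same = cong ListAction.sum
  (List.map-cong (λ v → cong (λ b → if b then 1 else 0) (same v)) (allFin n))

module _ {n} (G : Graph n) where

  IsProper : ∀ {k} → (Fin n → Fin k) → Set
  IsProper c = ∀ u v → Edge G u v → c u ≢ c v

  edge-sym : ∀ {u v} → Edge G u v → Edge G v u
  edge-sym {u} {v} e = ≡.trans (Graph.sym G v u) e

  reach-≢⇒edge : ∀ {u v} → Reach G u v → u ≢ v → ∃[ a ] ∃[ b ] Edge G a b
  reach-≢⇒edge here               u≢u = ⊥-elim (u≢u refl)
  reach-≢⇒edge (step {v} {w} _ e) _   = v , w , e

  connected⇒edge : 2 ≤ n → Connected G → ∃[ a ] ∃[ b ] Edge G a b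
  connected⇒edge (s≤s (s≤s _)) conn = reach-≢⇒edge (conn zero (suc zero)) (λ ())

  ¬colourable-0 : Fin n → ¬ Colourable G 0
  ¬colourable-0 v (c , _) with c v
  ... | ()

  edge⇒¬colourable-1 : ∀ {a b} → Edge G a b → ¬ Colourable G 1
  edge⇒¬colourable-1 {a} {b} e (c , c-proper) with c a | c b | c-proper a b e
  ... | zero | zero | ca≢cb = ca≢cb refl

  bipartite⇒χ≡2 : ∀ {a b} → Edge G a b → Bipartite G → ChromaticNumberIs G 2
  bipartite⇒χ≡2 {a} e bip = bip , λ
    { 0 _ → ¬colourable-0 a
    ; 1 _ → edge⇒¬colourable-1 e
    ; (suc (suc _)) (s≤s (s≤s ()))
    }

  module _ (conn : Connected G) {c c′ : Fin n → Fin 2}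
           (c-proper : IsProper c) (c′-proper : IsProper c′) where

    agree-along : ∀ {u v} → Reach G u v → c u ≡ c′ u → c v ≡ c′ v
    agree-along here               agree = agree
    agree-along (step {v} {w} p e) agree =
      fin2-≢-≢⇒≡ (λ c′v≡cw → c-proper v w e (≡.trans (agree-along p agree) c′v≡cw)) (c′-proper v w e)

    unique-up-to-swap : Fin n → (∀ v → c v ≡ c′ v) ⊎ (∀ v → c v ≡ opposite (c′ v))
    unique-up-to-swap z with c z ≟ᶠ c′ z
    ... | yes agree    = inj₁ λ v → agree-along (conn z v) agree
    ... | no  disagree = inj₂ λ v →
      fin2-≢⇒≡opposite λ c′v≡cv → disagree (agree-along (conn v z) (≡.sym c′v≡cv))

    classSize-up-to-swap : Fin n → ∀ i →
      classSize c i ≡ classSize c′ i ⊎ classSize c i ≡ classSize c′ (opposite i)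
    classSize-up-to-swap z i with unique-up-to-swap z
    ... | inj₁ same    = inj₁ (classSize-cong c c′ λ v → cong (λ x → does (x ≟ᶠ i)) (same v))
    ... | inj₂ swapped = inj₂ (classSize-cong c c′ λ v →
      ≡.trans (cong (λ x → does (x ≟ᶠ i)) (swapped v)) (does-opposite-≟ (c′ v) i))

  ugly⇒classes-odd : Bipartite G → Ugly G → ∀ c → IsProper c → ∀ i → Odd (classSize c i)
  ugly⇒classes-odd _   (_ , _ , inj₁ (zero , _ , odd))               = odd
  ugly⇒classes-odd bip (_ , _ , inj₁ (suc k , (_ , χ-minimal) , _))   =
    ⊥-elim (χ-minimal 2 (s≤s (m≤n+m 2 _)) bip)
  ugly⇒classes-odd bip (_ , _ , inj₂ (q , q≥2 , (_ , χ-minimal) , _)) =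
    ⊥-elim (χ-minimal 2 (^-monoʳ-< 2 (s≤s (s≤s z≤n)) q≥2) bip)

  classes-odd⇒ugly : 3 ≤ n → Connected G → ∀ c → IsProper c → (∀ i → Odd (classSize c i)) → Ugly G
  classes-odd⇒ugly n≥3 conn c c-proper odd =
    conn , n≥3 , inj₁ (0 , bipartite⇒χ≡2 (proj₂ (proj₂ edge)) (c , c-proper) , all-odd)
    where
    edge : ∃[ a ] ∃[ b ] Edge G a b
    edge = connected⇒edge (<⇒≤ n≥3) conn
    all-odd : ∀ c′ → IsProper c′ → ∀ i → Odd (classSize c′ i)
    all-odd c′ c′-proper i with classSize-up-to-swap conn c′-proper c-proper (proj₁ edge) i
    ... | inj₁ same    = ≡.subst Odd (≡.sym same) (odd i)
    ... | inj₂ swapped = ≡.subst Odd (≡.sym swapped) (odd (opposite i))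

  ¬ugly⇒even-class : 3 ≤ n → Connected G → ∀ c → IsProper c → ¬ Ugly G → ∃[ j ] classSize c j % 2 ≡ 0
  ¬ugly⇒even-class n≥3 conn c c-proper ¬ugly
    with classSize c zero % 2 ≟ 1 | classSize c (suc zero) % 2 ≟ 1
  ... | no ¬odd₀ | _        = zero , ¬odd⇒even (classSize c zero) ¬odd₀
  ... | yes _    | no ¬odd₁ = suc zero , ¬odd⇒even (classSize c (suc zero)) ¬odd₁
  ... | yes odd₀ | yes odd₁ =
    ⊥-elim (¬ugly (classes-odd⇒ugly n≥3 conn c c-proper λ { zero → odd₀ ; (suc zero) → odd₁ }))

module LabellingsOver (A : AbelianGroup 0ℓ 0ℓ) where

  open AbelianGroup A
    renaming (_∙_ to _+_; ε to 0#; _⁻¹ to -_; refl to ≈-refl; sym to ≈-sym; trans to ≈-trans)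
  open Group group using (_//_; _\\_)
  open import Algebra.Properties.AbelianGroup A
    using (ε⁻¹≈ε; ⁻¹-involutive; inverseˡ-unique; identityʳ-unique; //-rightDividesˡ; y≈x\\z)
  open import Algebra.Properties.CommutativeMonoid.Sum commutativeMonoid
    using (sum; sum-syntax; sum-cong-≋; sum-replicate-zero; ∑-distrib-+; ∑-comm)
  open import Algebra.Properties.Monoid.Mult monoid using (×-homo-1; ×-homo-+) renaming (_×_ to _·_)
  open import Relation.Binary.Reasoning.Setoid setoid

  Labelling : ℕ → Set
  Labelling n = Fin n → Fin n → Carrier

  Symmetric : ∀ {n} → Labelling n → Set
  Symmetric f = ∀ u v → f u v ≈ f v u

  deg : ∀ {n} → Graph n → Labelling n → Fin n → Carrier
  deg = weightedDegree A

  HasVertexColouring : ∀ {n} → Graph n → Set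
  HasVertexColouring {n} G = Σ (Labelling n) λ f → IsEdgeLabelling A G f × VertexColouring A G f

  HasThreeElements : Set
  HasThreeElements = ∀ x y → ∃[ t ] t ≉ x × t ≉ y

  δ : ∀ {n} → Fin n → Carrier → Fin n → Carrier
  δ a x v = if does (a ≟ᶠ v) then x else 0#

  δ-cong : ∀ {n} (a : Fin n) {x y} → x ≈ y → ∀ v → δ a x v ≈ δ a y v
  δ-cong a x≈y v with does (a ≟ᶠ v)
  ... | true  = x≈y
  ... | false = ≈-refl

  if-0# : ∀ b → (if b then 0# else 0#) ≈ 0#
  if-0# true  = ≈-refl
  if-0# false = ≈-refl

  if-distrib-+ : ∀ b x y → (if b then x + y else 0#) ≈ (if b then x else 0#) + (if b then y else 0#)
  if-distrib-+ true  x y = ≈-refl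
  if-distrib-+ false x y = ≈-sym (identityˡ 0#)

  δ-cancel : ∀ {n} (a : Fin n) x v → δ a x v + δ a (- x) v ≈ 0#
  δ-cancel a x v with does (a ≟ᶠ v)
  ... | true  = inverseʳ x
  ... | false = identityˡ 0#

  +-cancel-middle : ∀ a b c d → b + c ≈ 0# → (a + b) + (c + d) ≈ a + d
  +-cancel-middle a b c d b+c≈0 = begin
    (a + b) + (c + d) ≈⟨ assoc a b (c + d) ⟩
    a + (b + (c + d)) ≈⟨ ∙-congˡ (assoc b c d) ⟨
    a + ((b + c) + d) ≈⟨ ∙-congˡ (∙-congʳ b+c≈0) ⟩
    a + (0# + d)      ≈⟨ ∙-congˡ (identityˡ d) ⟩
    a + d             ∎

  ∑-0# : ∀ n → ∑[ v < n ] 0# ≈ 0#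
  ∑-0# = sum-replicate-zero

  ∑-if : ∀ {n} b (h : Fin n → Carrier) → ∑[ v < n ] (if b then h v else 0#) ≈ (if b then sum h else 0#)
  ∑-if true  h = ≈-refl
  ∑-if {n} false h = ∑-0# n

  ∑-δ : ∀ {n} (a : Fin n) (h : Fin n → Carrier) → ∑[ v < n ] δ a (h v) v ≈ h a
  ∑-δ {suc n} zero    h = ≈-trans (∙-congˡ (∑-0# n)) (identityʳ (h zero))
  ∑-δ {suc n} (suc a) h = ≈-trans (identityˡ _) (∑-δ a (h ∘ suc))

  ∑-δ-point : ∀ {n} (h : Fin n → Carrier) u → ∑[ v < n ] δ v (h v) u ≈ h u
  ∑-δ-point h u = ≈-trans
    (sum-cong-≋ λ v → reflexive (cong (λ b → if b then h v else 0#) (does-≟-sym v u)))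
    (∑-δ u h)

  ∑-indicator : ∀ {n} (p : Fin n → Bool) x →
    ∑[ v < n ] (if p v then x else 0#) ≈ ListAction.sum (tabulate λ v → if p v then 1 else 0) · x
  ∑-indicator {zero}  p x = ≈-refl
  ∑-indicator {suc n} p x =
    ≈-trans (∙-cong (indicator (p zero)) (∑-indicator (p ∘ suc) x))
            (≈-sym (×-homo-+ x (if p zero then 1 else 0) _))
    where
    indicator : ∀ b → (if b then x else 0#) ≈ (if b then 1 else 0) · x
    indicator true  = ≈-sym (×-homo-1 x)
    indicator false = ≈-refl

  ∑-class : ∀ {n k} (c : Fin n → Fin k) i x →
    ∑[ v < n ] (if does (c v ≟ᶠ i) then x else 0#) ≈ classSize c i · x
  ∑-class {n} c i x = ≈-trans (∑-indicator (λ v → does (c v ≟ᶠ i)) x)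
    (reflexive (cong (λ m → ListAction.sum m · x) (≡.sym (List.map-tabulate (λ v → v) indicator))))
    where
    indicator : Fin n → ℕ
    indicator v = if does (c v ≟ᶠ i) then 1 else 0

  module _ {n} (G : Graph n) where

    deg-0# : ∀ v → deg G (λ _ _ → 0#) v ≈ 0#
    deg-0# v = ≈-trans (sum-cong-≋ λ u → if-0# (adj G v u)) (∑-0# n)

    deg-+ : ∀ (f g : Labelling n) v → deg G (λ u u′ → f u u′ + g u u′) v ≈ deg G f v + deg G g v
    deg-+ f g v = ≈-trans (sum-cong-≋ λ u → if-distrib-+ (adj G v u) (f v u) (g v u))
      (∑-distrib-+ (λ u → if adj G v u then f v u else 0#) (λ u → if adj G v u then g v u else 0#))

    deg-∑ : ∀ {m} (F : Fin m → Labelling n) v →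
      deg G (λ u u′ → ∑[ i < m ] F i u u′) v ≈ ∑[ i < m ] deg G (F i) v
    deg-∑ F v = ≈-trans (sum-cong-≋ λ u → ≈-sym (∑-if (adj G v u) λ i → F i v u))
      (∑-comm λ u i → if adj G v u then F i v u else 0#)

    arc : Fin n → Fin n → Carrier → Labelling n
    arc a b x u u′ = if does (a ≟ᶠ u) ∧ does (b ≟ᶠ u′) then x else 0#

    deg-arc : ∀ {a b} x → Edge G a b → ∀ v → deg G (arc a b x) v ≈ δ a x v
    deg-arc {a} {b} x e v with a ≟ᶠ v
    ... | yes refl = ≈-trans (sum-cong-≋ along-edge) (∑-δ b λ _ → x)
      where
      along-edge : ∀ u → (if adj G a u then δ b x u else 0#) ≈ δ b x u
      along-edge u with b ≟ᶠ u
      ... | yes refl rewrite e = ≈-refl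
      ... | no _               = if-0# (adj G a u)
    ... | no _     = ≈-trans (sum-cong-≋ λ u → if-0# (adj G v u)) (∑-0# n)

    edgeLabel : Fin n → Fin n → Carrier → Labelling n
    edgeLabel a b x u u′ = arc a b x u u′ + arc b a x u u′

    edgeLabel-sym : ∀ a b x → Symmetric (edgeLabel a b x)
    edgeLabel-sym a b x u u′ = ≈-trans (∙-cong (swap a b) (swap b a)) (comm _ _)
      where
      swap : ∀ a b → arc a b x u u′ ≈ arc b a x u′ u
      swap a b = reflexive (cong (λ t → if t then x else 0#) (∧-comm (does (a ≟ᶠ u)) (does (b ≟ᶠ u′))))

    deg-edgeLabel : ∀ {a b} x → Edge G a b → ∀ v → deg G (edgeLabel a b x) v ≈ δ a x v + δ b x v
    deg-edgeLabel {a} {b} x e v =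
      ≈-trans (deg-+ (arc a b x) (arc b a x) v) (∙-cong (deg-arc x e v) (deg-arc x (edge-sym G e) v))

    -- The edges of the walk are labelled x, -x, x, …, so the labels cancel at every
    -- interior vertex.
    endValue : ∀ {s t} → Reach G s t → Carrier → Carrier
    endValue here       x = - x
    endValue (step p _) x = - endValue p x

    walkLabel : ∀ {s t} → Reach G s t → Carrier → Labelling n
    walkLabel here               _ _ _  = 0#
    walkLabel (step {v} {w} p _) x u u′ = walkLabel p x u u′ + edgeLabel v w (- endValue p x) u u′

    walkLabel-sym : ∀ {s t} (p : Reach G s t) x → Symmetric (walkLabel p x)
    walkLabel-sym here               x u u′ = ≈-refl
    walkLabel-sym (step {v} {w} p _) x u u′ =
      ∙-cong (walkLabel-sym p x u u′) (edgeLabel-sym v w (- endValue p x) u u′)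

    deg-walkLabel : ∀ {s t} (p : Reach G s t) x v →
      deg G (walkLabel p x) v ≈ δ s x v + δ t (endValue p x) v
    deg-walkLabel {s} here x v = ≈-trans (deg-0# v) (≈-sym (δ-cancel s x v))
    deg-walkLabel {s} (step {v} {w} p e) x u = begin
      deg G (walkLabel (step p e) x) u
        ≈⟨ deg-+ (walkLabel p x) (edgeLabel v w (- y)) u ⟩
      deg G (walkLabel p x) u + deg G (edgeLabel v w (- y)) u
        ≈⟨ ∙-cong (deg-walkLabel p x u) (deg-edgeLabel (- y) e u) ⟩
      (δ s x u + δ v y u) + (δ v (- y) u + δ w (- y) u)
        ≈⟨ +-cancel-middle _ _ _ _ (δ-cancel v y u) ⟩
      δ s x u + δ w (- y) u ∎
      where
      y : Carrier
      y = endValue p x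

    endValue-sign : ∀ {c : Fin n → Fin 2} → IsProper G c →
      ∀ {s t} (p : Reach G s t) x → endValue p x ≈ (if does (c s ≟ᶠ c t) then - x else x)
    endValue-sign {c} _ {s} here x with c s ≟ᶠ c s
    ... | yes _  = ≈-refl
    ... | no ≢cs = ⊥-elim (≢cs refl)
    endValue-sign {c} c-proper {s} (step {v} {w} p e) x
      with c s ≟ᶠ c v | c s ≟ᶠ c w | endValue-sign c-proper p x
    ... | yes cs≡cv | yes cs≡cw | _  = ⊥-elim (c-proper v w e (≡.trans (≡.sym cs≡cv) cs≡cw))
    ... | yes _     | no _      | ih = ≈-trans (⁻¹-cong ih) (⁻¹-involutive x)
    ... | no _      | yes _     | ih = ⁻¹-cong ih
    ... | no cs≢cv  | no cs≢cw  | _  = ⊥-elim (c-proper v w e (fin2-≢-≢⇒≡ cs≢cv cs≢cw))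

  module Realisation {n} (G : Graph n) (conn : Connected G)
                     {c : Fin n → Fin 2} (c-proper : IsProper G c) (r : Fin n) where

    signedSum : (Fin n → Carrier) → Carrier
    signedSum d = ∑[ v < n ] (if does (c v ≟ᶠ c r) then - d v else d v)

    realise : (Fin n → Carrier) → Labelling n
    realise d u u′ = ∑[ v < n ] walkLabel G (conn v r) (d v) u u′

    realise-sym : ∀ d → Symmetric (realise d)
    realise-sym d u u′ = sum-cong-≋ λ v → walkLabel-sym G (conn v r) (d v) u u′

    deg-realise : ∀ d u → deg G (realise d) u ≈ d u + δ r (signedSum d) u
    deg-realise d u = begin
      deg G (realise d) u
        ≈⟨ deg-∑ G (λ v → walkLabel G (conn v r) (d v)) u ⟩
      ∑[ v < n ] deg G (walkLabel G (conn v r) (d v)) u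
        ≈⟨ sum-cong-≋ (λ v → deg-walkLabel G (conn v r) (d v) u) ⟩
      ∑[ v < n ] (δ v (d v) u + δ r (end v) u)
        ≈⟨ ∑-distrib-+ (λ v → δ v (d v) u) (λ v → δ r (end v) u) ⟩
      ∑[ v < n ] δ v (d v) u + ∑[ v < n ] δ r (end v) u
        ≈⟨ ∙-cong (∑-δ-point d u) (∑-if (does (r ≟ᶠ u)) end) ⟩
      d u + δ r (sum end) u
        ≈⟨ ∙-congˡ (δ-cong r (sum-cong-≋ λ v → endValue-sign G c-proper (conn v r) (d v)) u) ⟩
      d u + δ r (signedSum d) u ∎
      where
      end : Fin n → Carrier
      end v = endValue G (conn v r) (d v)

    deg-realise-≢ : ∀ d {v} → v ≢ r → deg G (realise d) v ≈ d v
    deg-realise-≢ d {v} v≢r with r ≟ᶠ v | deg-realise d v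
    ... | yes r≡v | _      = ⊥-elim (v≢r (≡.sym r≡v))
    ... | no _    | deg≈dv = ≈-trans deg≈dv (identityʳ (d v))

    deg-realise-root : ∀ d → deg G (realise d) r ≈ d r + signedSum d
    deg-realise-root d with r ≟ᶠ r | deg-realise d r
    ... | yes _   | deg≈ = deg≈
    ... | no r≢r  | _    = ⊥-elim (r≢r refl)

    deg-realise-balanced : ∀ d → signedSum d ≈ 0# → ∀ v → deg G (realise d) v ≈ d v
    deg-realise-balanced d balanced v with v ≟ᶠ r
    ... | yes refl = ≈-trans (deg-realise-root d) (≈-trans (∙-congˡ balanced) (identityʳ (d v)))
    ... | no v≢r   = deg-realise-≢ d v≢r

  separated⇒vertexColouring : ∀ {n} (G : Graph n) {c : Fin n → Fin 2} → IsProper G c →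
    ∀ {f : Labelling n} i b → (∀ v → c v ≡ i → deg G f v ≉ b) → (∀ v → c v ≢ i → deg G f v ≈ b) →
    VertexColouring A G f
  separated⇒vertexColouring G {c} c-proper i b inside outside u v e du≈dv with c u ≟ᶠ i | c v ≟ᶠ i
  ... | yes cu≡i | yes cv≡i = c-proper u v e (≡.trans cu≡i (≡.sym cv≡i))
  ... | yes cu≡i | no  cv≢i = inside u cu≡i (≈-trans du≈dv (outside v cv≢i))
  ... | no  cu≢i | yes cv≡i = inside v cv≡i (≈-trans (≈-sym du≈dv) (outside u cu≢i))
  ... | no  cu≢i | no  cv≢i = c-proper u v e (fin2-≢-≢⇒≡ (cu≢i ∘ ≡.sym) (cv≢i ∘ ≡.sym))

  module TwoElements {g : Carrier} (g≉0 : g ≉ 0#) (dichotomy : ∀ x → x ≈ 0# ⊎ x ≈ g) where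

    x+x≈0 : ∀ x → x + x ≈ 0#
    x+x≈0 x with dichotomy x | dichotomy (g + g)
    ... | inj₁ x≈0 | _          = ≈-trans (∙-cong x≈0 x≈0) (identityˡ 0#)
    ... | inj₂ x≈g | inj₁ g+g≈0 = ≈-trans (∙-cong x≈g x≈g) g+g≈0
    ... | inj₂ _   | inj₂ g+g≈g = ⊥-elim (g≉0 (identityʳ-unique g g g+g≈g))

    -x≈x : ∀ x → - x ≈ x
    -x≈x x = ≈-sym (inverseˡ-unique x x (x+x≈0 x))

    ·-mod-2 : ∀ m x → m · x ≈ (m % 2) · x
    ·-mod-2 0             x = ≈-refl
    ·-mod-2 1             x = ≈-refl
    ·-mod-2 (suc (suc m)) x = begin
      x + (x + m · x) ≈⟨ assoc x x (m · x) ⟨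
      (x + x) + m · x ≈⟨ ∙-congʳ (x+x≈0 x) ⟩
      0# + m · x      ≈⟨ identityˡ (m · x) ⟩
      m · x           ≈⟨ ·-mod-2 m x ⟩
      (m % 2) · x     ∎

    odd-· : ∀ m → Odd m → ∀ x → m · x ≈ x
    odd-· m odd x = ≈-trans (·-mod-2 m x) (≈-trans (reflexive (cong (_· x) odd)) (×-homo-1 x))

    even-· : ∀ m → m % 2 ≡ 0 → ∀ x → m · x ≈ 0#
    even-· m even x = ≈-trans (·-mod-2 m x) (reflexive (cong (_· x) even))

    ∑∑-symmetric≈0 : ∀ {n} (h : Labelling n) → Symmetric h → (∀ u → h u u ≈ 0#) →
      ∑[ u < n ] ∑[ v < n ] h u v ≈ 0#
    ∑∑-symmetric≈0 {zero}  h h-sym h-diag = ≈-refl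
    ∑∑-symmetric≈0 {suc n} h h-sym h-diag = begin
      (h zero zero + row) + ∑[ u < n ] (h (suc u) zero + ∑[ v < n ] h (suc u) (suc v))
        ≈⟨ ∙-congˡ (∑-distrib-+ (λ u → h (suc u) zero) (λ u → ∑[ v < n ] h (suc u) (suc v))) ⟩
      (h zero zero + row) + (column + ∑[ u < n ] ∑[ v < n ] h (suc u) (suc v))
        ≈⟨ +-cancel-middle _ _ _ _ row+column≈0 ⟩
      h zero zero + ∑[ u < n ] ∑[ v < n ] h (suc u) (suc v)
        ≈⟨ ∙-cong (h-diag zero) (∑∑-symmetric≈0 (λ u v → h (suc u) (suc v))
                                               (λ u v → h-sym (suc u) (suc v)) (h-diag ∘ suc)) ⟩
      0# + 0#
        ≈⟨ identityˡ 0# ⟩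
      0# ∎
      where
      row column : Carrier
      row    = ∑[ v < n ] h zero (suc v)
      column = ∑[ u < n ] h (suc u) zero
      row+column≈0 : row + column ≈ 0#
      row+column≈0 = ≈-trans (≈-sym (∑-distrib-+ (λ v → h zero (suc v)) (λ u → h (suc u) zero)))
        (≈-trans (sum-cong-≋ λ v → ≈-trans (∙-congˡ (h-sym (suc v) zero)) (x+x≈0 _)) (∑-0# n))

    handshake : ∀ {n} (G : Graph n) f → IsEdgeLabelling A G f → ∑[ v < n ] deg G f v ≈ 0#
    handshake {n} G f f-label = ∑∑-symmetric≈0 h h-sym h-diag
      where
      h : Labelling n
      h v u = if adj G v u then f v u else 0#
      h-sym : Symmetric h
      h-sym v u with adj G v u in e
      ... | true  rewrite ≡.trans (Graph.sym G u v) e = f-label v u e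
      ... | false rewrite ≡.trans (Graph.sym G u v) e = ≈-refl
      h-diag : ∀ u → h u u ≈ 0#
      h-diag u rewrite Graph.irrefl G u = ≈-refl

    module _ {n} (G : Graph n) (conn : Connected G) {c : Fin n → Fin 2} (c-proper : IsProper G c)
             (r : Fin n) where
      open Realisation G conn c-proper r

      classIndicator : Fin 2 → Fin n → Carrier
      classIndicator j v = if does (c v ≟ᶠ j) then g else 0#

      signedSum-classIndicator : ∀ j → signedSum (classIndicator j) ≈ classSize c j · g
      signedSum-classIndicator j = ≈-trans (sum-cong-≋ unsigned) (∑-class c j g)
        where
        unsigned : ∀ v → (if does (c v ≟ᶠ c r) then - classIndicator j v else classIndicator j v)
                         ≈ classIndicator j v
        unsigned v with does (c v ≟ᶠ c r)
        ... | true  = -x≈x (classIndicator j v)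
        ... | false = ≈-refl

      even-class⇒vertexColouring : ∀ j → classSize c j % 2 ≡ 0 → HasVertexColouring G
      even-class⇒vertexColouring j even =
        realise d , (λ u v _ → realise-sym d u v) ,
        separated⇒vertexColouring G c-proper j 0# inside outside
        where
        d : Fin n → Carrier
        d = classIndicator j
        deg≈d : ∀ v → deg G (realise d) v ≈ d v
        deg≈d = deg-realise-balanced d
          (≈-trans (signedSum-classIndicator j) (even-· (classSize c j) even g))
        inside : ∀ v → c v ≡ j → deg G (realise d) v ≉ 0#
        inside v cv≡j with c v ≟ᶠ j | deg≈d v
        ... | yes _   | deg≈g = g≉0 ∘ ≈-trans (≈-sym deg≈g)
        ... | no cv≢j | _     = ⊥-elim (cv≢j cv≡j)
        outside : ∀ v → c v ≢ j → deg G (realise d) v ≈ 0#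
        outside v cv≢j with c v ≟ᶠ j | deg≈d v
        ... | yes cv≡j | _     = ⊥-elim (cv≢j cv≡j)
        ... | no _     | deg≈0 = deg≈0

    odd-classes⇒¬vertexColouring : ∀ {n} (G : Graph n) →
      (∀ c → IsProper G c → Odd (classSize c (suc zero))) → ¬ HasVertexColouring G
    odd-classes⇒¬vertexColouring {n} G odd (f , f-label , f-colouring) = g≉0 (begin
      g                                                      ≈⟨ odd-· size₁ (odd c c-proper) g ⟨
      size₁ · g                                              ≈⟨ ∑-class c (suc zero) g ⟨
      ∑[ v < n ] (if does (c v ≟ᶠ suc zero) then g else 0#) ≈⟨ sum-cong-≋ degree-by-class ⟨
      ∑[ v < n ] deg G f v                                   ≈⟨ handshake G f f-label ⟩
      0#                                                     ∎)
      where
      weightClass : ∀ {x} → x ≈ 0# ⊎ x ≈ g → Fin 2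
      weightClass (inj₁ _) = zero
      weightClass (inj₂ _) = suc zero
      c : Fin n → Fin 2
      c v = weightClass (dichotomy (deg G f v))
      size₁ : ℕ
      size₁ = classSize c (suc zero)
      c-proper : IsProper G c
      c-proper u v e with dichotomy (deg G f u) | dichotomy (deg G f v)
      ... | inj₁ du≈0 | inj₁ dv≈0 = λ _ → f-colouring u v e (≈-trans du≈0 (≈-sym dv≈0))
      ... | inj₁ _    | inj₂ _    = λ ()
      ... | inj₂ _    | inj₁ _    = λ ()
      ... | inj₂ du≈g | inj₂ dv≈g = λ _ → f-colouring u v e (≈-trans du≈g (≈-sym dv≈g))
      degree-by-class : ∀ v → deg G f v ≈ (if does (c v ≟ᶠ suc zero) then g else 0#)
      degree-by-class v with dichotomy (deg G f v)
      ... | inj₁ deg≈0 = deg≈0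
      ... | inj₂ deg≈g = deg≈g

  module ThreeElements (avoid : HasThreeElements) {n} (G : Graph n) (conn : Connected G)
                       {c : Fin n → Fin 2} (c-proper : IsProper G c)
                       {r s : Fin n} (s≢r : s ≢ r) (cs≡cr : c s ≡ c r) where
    open Realisation G conn c-proper r

    b : Carrier
    b = proj₁ (avoid 0# 0#)

    b≉0 : b ≉ 0#
    b≉0 = proj₁ (proj₂ (avoid 0# 0#))

    demand : Carrier → Fin n → Carrier
    demand t v = if does (c v ≟ᶠ c r) then δ s t v else b

    S : Carrier
    S = ∑[ v < n ] (if does (c v ≟ᶠ c r) then 0# else b)

    signedSum-demand : ∀ t → signedSum (demand t) ≈ S // t
    signedSum-demand t = begin
      signedSum (demand t)
        ≈⟨ sum-cong-≋ split ⟩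
      ∑[ v < n ] ((if does (c v ≟ᶠ c r) then 0# else b) + δ s (- t) v)
        ≈⟨ ∑-distrib-+ (λ v → if does (c v ≟ᶠ c r) then 0# else b) (λ v → δ s (- t) v) ⟩
      S + ∑[ v < n ] δ s (- t) v
        ≈⟨ ∙-congˡ (∑-δ s λ _ → - t) ⟩
      S // t ∎
      where
      split : ∀ v → (if does (c v ≟ᶠ c r) then - demand t v else demand t v)
                    ≈ (if does (c v ≟ᶠ c r) then 0# else b) + δ s (- t) v
      split v with c v ≟ᶠ c r | s ≟ᶠ v
      ... | yes _      | yes _    = ≈-sym (identityˡ (- t))
      ... | yes _      | no _     = ≈-trans ε⁻¹≈ε (≈-sym (identityˡ 0#))
      ... | no cv≢cr   | yes refl = ⊥-elim (cv≢cr cs≡cr)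
      ... | no _       | no _     = ≈-sym (identityʳ b)

    -- The value at s is chosen so that neither s nor the root r (which receives S // t) gets b.
    t : Carrier
    t = proj₁ (avoid b (b \\ S))

    t≉b : t ≉ b
    t≉b = proj₁ (proj₂ (avoid b (b \\ S)))

    t≉b\\S : t ≉ b \\ S
    t≉b\\S = proj₂ (proj₂ (avoid b (b \\ S)))

    S//t≉b : S // t ≉ b
    S//t≉b S//t≈b = t≉b\\S
      (y≈x\\z b t S (≈-trans (∙-congʳ (≈-sym S//t≈b)) (//-rightDividesˡ t S)))

    δst≉b : ∀ v → δ s t v ≉ b
    δst≉b v with does (s ≟ᶠ v)
    ... | true  = t≉b
    ... | false = b≉0 ∘ ≈-sym

    f : Labelling n
    f = realise (demand t)

    deg-root : deg G f r ≈ S // t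
    deg-root with c r ≟ᶠ c r | s ≟ᶠ r | deg-realise-root (demand t)
    ... | yes _    | no _    | deg≈ = ≈-trans deg≈ (≈-trans (∙-congˡ (signedSum-demand t)) (identityˡ _))
    ... | no cr≢cr | _       | _    = ⊥-elim (cr≢cr refl)
    ... | yes _    | yes s≡r | _    = ⊥-elim (s≢r s≡r)

    inside : ∀ v → c v ≡ c r → deg G f v ≉ b
    inside v cv≡cr with v ≟ᶠ r
    ... | yes refl = S//t≉b ∘ ≈-trans (≈-sym deg-root)
    ... | no v≢r with c v ≟ᶠ c r | deg-realise-≢ (demand t) v≢r
    ...   | yes _    | deg≈δ = δst≉b v ∘ ≈-trans (≈-sym deg≈δ)
    ...   | no cv≢cr | _     = ⊥-elim (cv≢cr cv≡cr)

    outside : ∀ v → c v ≢ c r → deg G f v ≈ b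
    outside v cv≢cr with c v ≟ᶠ c r | deg-realise-≢ (demand t) (cv≢cr ∘ cong c)
    ... | yes cv≡cr | _     = ⊥-elim (cv≢cr cv≡cr)
    ... | no _      | deg≈b = deg≈b

    hasVertexColouring : HasVertexColouring G
    hasVertexColouring =
      f , (λ u v _ → realise-sym (demand t) u v) ,
      separated⇒vertexColouring G c-proper (c r) b inside outside

module Order (A : AbelianGroup 0ℓ 0ℓ) where
  open AbelianGroup A using (Carrier; _≈_; _≉_; ε)

  order-2⇒two-elements : HasOrder A 2 → ∃[ g ] g ≉ ε × (∀ x → x ≈ ε ⊎ x ≈ g)
  order-2⇒two-elements ord = g , g≉ε , dichotomy
    where
    open Bijection ord renaming (cong to to-cong)
    g : Carrier
    g = to⁻ (opposite (to ε))
    to-g : to g ≡ opposite (to ε)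
    to-g = proj₂ (strictlySurjective (opposite (to ε)))
    g≉ε : g ≉ ε
    g≉ε g≈ε = opposite-≢ (to ε) (≡.trans (≡.sym to-g) (to-cong g≈ε))
    dichotomy : ∀ x → x ≈ ε ⊎ x ≈ g
    dichotomy x with to x ≟ᶠ to ε
    ... | yes same  = inj₁ (injective same)
    ... | no differ = inj₂ (injective (≡.trans (fin2-≢⇒≡opposite (differ ∘ ≡.sym)) (≡.sym to-g)))

  order-≥3⇒three-elements : ∀ {m} → HasOrder A (3 ℕ.+ m) → LabellingsOver.HasThreeElements A
  order-≥3⇒three-elements ord x y = t , proj₁ k-avoids ∘ to-t≡ , proj₂ k-avoids ∘ to-t≡
    where
    open Bijection ord renaming (cong to to-cong)
    k : Fin _
    k = proj₁ (avoid-two (to x) (to y))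
    k-avoids : k ≢ to x × k ≢ to y
    k-avoids = proj₂ (avoid-two (to x) (to y))
    t : Carrier
    t = to⁻ k
    to-t≡ : ∀ {z} → t ≈ z → k ≡ to z
    to-t≡ t≈z = ≡.trans (≡.sym (proj₂ (strictlySurjective k))) (to-cong t≈z)

trivialGroup : AbelianGroup 0ℓ 0ℓ
trivialGroup = Terminal.abelianGroup

trivialGroup-order : HasOrder trivialGroup 1
trivialGroup-order = record
  { to        = λ _ → zero
  ; cong      = λ _ → refl
  ; bijective = (λ _ → tt) , λ { zero → tt , λ _ → refl }
  }

xorGroup : AbelianGroup 0ℓ 0ℓ
xorGroup = CommutativeRing.+-abelianGroup xor-∧-commutativeRing

xorGroup-order : HasOrder xorGroup 2
xorGroup-order = ↔⇒⤖ (↔-sym 2↔Bool)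

module _ {n} (G : Graph n) where

  edge⇒¬groupColourable-1 : ∀ {a b} → Edge G a b → ¬ GroupColourable G 1
  edge⇒¬groupColourable-1 {a} {b} e colourable with colourable trivialGroup trivialGroup-order
  ... | _ , _ , f-colouring = f-colouring a b e tt

  odd-classes⇒¬groupColourable-2 : (∀ c → IsProper G c → Odd (classSize c (suc zero))) →
    ¬ GroupColourable G 2
  odd-classes⇒¬groupColourable-2 odd colourable with Order.order-2⇒two-elements xorGroup xorGroup-order
  ... | _ , g≉0 , dichotomy =
    LabellingsOver.TwoElements.odd-classes⇒¬vertexColouring xorGroup g≉0 dichotomy G odd
      (colourable xorGroup xorGroup-order)

  module _ (conn : Connected G) {c : Fin n → Fin 2} (c-proper : IsProper G c) where

    even-class⇒groupColourable-2 : Fin n → ∀ j → classSize c j % 2 ≡ 0 → GroupColourable G 2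
    even-class⇒groupColourable-2 r j even A ord with Order.order-2⇒two-elements A ord
    ... | _ , g≉0 , dichotomy =
      LabellingsOver.TwoElements.even-class⇒vertexColouring A g≉0 dichotomy G conn c-proper r j even

    groupColourable-≥3 : 3 ≤ n → ∀ m → GroupColourable G (3 ℕ.+ m)
    groupColourable-≥3 n≥3 m A ord with monochromatic-pair n≥3 c
    ... | r , s , s≢r , cs≡cr =
      LabellingsOver.ThreeElements.hasVertexColouring A (Order.order-≥3⇒three-elements A ord)
        G conn c-proper s≢r cs≡cr

lemma2p2 : ∀ (n : ℕ) (G : Graph n) → 3 ≤ n → Connected G → Bipartite G →
    (Ugly G → GroupSumChromaticNumberIs G 3) × (¬ Ugly G → GroupSumChromaticNumberIs G 2)
lemma2p2 n G n≥3 conn bip@(c , c-proper) = ugly-case , not-ugly-case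
  where
  edge : ∃[ a ] ∃[ b ] Edge G a b
  edge = connected⇒edge G (<⇒≤ n≥3) conn

  ¬groupColourable-1 : ¬ GroupColourable G 1
  ¬groupColourable-1 = edge⇒¬groupColourable-1 G (proj₂ (proj₂ edge))

  ugly-case : Ugly G → GroupSumChromaticNumberIs G 3
  ugly-case ugly = s≤s z≤n , groupColourable-≥3 G conn c-proper n≥3 0 , λ
    { 0 () _
    ; 1 _ _ → ¬groupColourable-1
    ; 2 _ _ → odd-classes⇒¬groupColourable-2 G λ c′ c′-proper →
        ugly⇒classes-odd G bip ugly c′ c′-proper (suc zero)
    ; (suc (suc (suc _))) _ (s≤s (s≤s (s≤s ())))
    }

  not-ugly-case : ¬ Ugly G → GroupSumChromaticNumberIs G 2
  not-ugly-case ¬ugly = s≤s z≤n , colourable , λ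
    { 0 () _
    ; 1 _ _ → ¬groupColourable-1
    ; (suc (suc _)) _ (s≤s (s≤s ()))
    }
    where
    colourable : GroupColourable G 2
    colourable = uncurry (even-class⇒groupColourable-2 G conn c-proper (proj₁ edge))
                         (¬ugly⇒even-class G n≥3 conn c c-proper ¬ugly)
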